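{- For every $n\ge1$ there is a bijection $\Phi:\mathbf{I}_n(\underline{\geq,>})\to\mathbf{I}_n(\underline{>,\geq})$ such that if $e'=\Phi(e)$ then $e'_n=e_n$.
   Context: An inversion sequence of length $n$ is an integer sequence $e=e_1\dots e_n$ with $0\le e_i<i$ for all $i$; $\mathbf{I}_n$ is the set of these. For relations $R_1,R_2$, $\mathbf{I}_n(\underline{R_1,R_2})$ is the set of $e\in\mathbf{I}_n$ with no index $i$ such that $e_iR_1e_{i+1}$ and $e_{i+1}R_2e_{i+2}$. -}

module Defs where

open import Data.Nat using (ℕ; zero; suc; _+_; _≤_; _<_; _≥_; _>_)
open import Data.Fin using (Fin; toℕ; fromℕ<; fromℕ)
open import Data.Vec using (Vec; lookup)
open import Data.Product using (Σ; _×_; proj₁)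
open import Relation.Nullary using (¬_)
open import Relation.Binary.PropositionalEquality using (_≡_)

-- A sequence of length n, entries indexed 0..n-1 (entry at Fin index i is e_{i+1}).
Seq : ℕ → Set
Seq n = Vec ℕ n

_!_ : ∀ {n} → Seq n → Fin n → ℕ
e ! i = lookup e i

IsInvSeq : ∀ {n} → Seq n → Set
IsInvSeq {n} e = ∀ (i : Fin n) → e ! i < suc (toℕ i)

-- e avoids the consecutive pattern (R₁,R₂): no position i (0-based, with i+2 < n)
-- such that  e_i R₁ e_{i+1}  and  e_{i+1} R₂ e_{i+2}.
Avoids : (ℕ → ℕ → Set) → (ℕ → ℕ → Set) → ∀ {n} → Seq n → Set
Avoids R₁ R₂ {n} e =
  ∀ (i : ℕ) (h : suc (suc i) < n) →
    ¬ ( R₁ (e ! (fromℕ< {i} {n} (Data.Nat.Properties.<-trans (Data.Nat.Properties.n<1+n i) (Data.Nat.Properties.<-trans (Data.Nat.Properties.n<1+n (suc i)) h))))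
           (e ! (fromℕ< {suc i} {n} (Data.Nat.Properties.<-trans (Data.Nat.Properties.n<1+n (suc i)) h)))
      × R₂ (e ! (fromℕ< {suc i} {n} (Data.Nat.Properties.<-trans (Data.Nat.Properties.n<1+n (suc i)) h)))
           (e ! (fromℕ< {suc (suc i)} {n} h)) )
  where import Data.Nat.Properties

I : (ℕ → ℕ → Set) → (ℕ → ℕ → Set) → ℕ → Set
I R₁ R₂ n = Σ (Seq n) (λ e → IsInvSeq e × Avoids R₁ R₂ e)

last : ∀ {m} → Seq (suc m) → ℕ
last {m} e = e ! fromℕ m

_≈I_ : ∀ {R₁ R₂ n} → I R₁ R₂ n → I R₁ R₂ n → Set
x ≈I y = proj₁ x ≡ proj₁ y

module Submission where

-- A sequence avoiding the consecutive pattern (≥,>) never has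
-- a plateau or descent immediately followed by a descent, so each descent
-- x > y is followed by a plateau  y^k  (k ≥ 1) and then by an entry > y
-- (or the end).  Φ keeps every weak ascent and rewrites each such block
--     x y^k  ↦  x^k y ,
-- which turns the sequence into one avoiding (>,≥).

open import Defs
open import Data.Nat using (ℕ; suc; zero; _≥_; _>_; _≤_; _<_; z≤n; s≤s; s≤s⁻¹; _+_)
open import Data.Nat.Properties
open import Data.Fin using (toℕ) renaming (zero to fzero; suc to fsuc)
open import Data.Vec using (Vec; []; _∷_; lookup)
open import Data.Product using (Σ; proj₁; proj₂; _×_; _,_)
open import Data.Unit using (⊤; tt)
open import Data.Empty using (⊥; ⊥-elim)
open import Relation.Nullary using (¬_; yes; no)
open import Relation.Binary using (tri<; tri≈; tri>)
open import Function using (Injective; Surjective; Bijective)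
open import Relation.Binary.PropositionalEquality using (_≡_; refl; cong; sym; subst; module ≡-Reasoning)

Av : (ℕ → ℕ → Set) → (ℕ → ℕ → Set) → ∀ {n} → Vec ℕ n → Set
Av R₁ R₂ (a ∷ b ∷ c ∷ r) = ¬ (R₁ a b × R₂ b c) × Av R₁ R₂ (b ∷ c ∷ r)
Av R₁ R₂ _ = ⊤

Av-tail : ∀ {R₁ R₂ n x} {r : Vec ℕ n} → Av R₁ R₂ (x ∷ r) → Av R₁ R₂ r
Av-tail {r = []} _ = tt
Av-tail {r = _ ∷ []} _ = tt
Av-tail {r = _ ∷ _ ∷ _} (_ , av) = av

Avoids-tail : ∀ {R₁ R₂ n x} {r : Vec ℕ n} → Avoids R₁ R₂ (x ∷ r) → Avoids R₁ R₂ r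
Avoids-tail av i i+2<n = av (suc i) (s≤s i+2<n)

Avoids⇒Av : ∀ {R₁ R₂ n} (e : Vec ℕ n) → Avoids R₁ R₂ e → Av R₁ R₂ e
Avoids⇒Av [] _ = tt
Avoids⇒Av (_ ∷ []) _ = tt
Avoids⇒Av (_ ∷ _ ∷ []) _ = tt
Avoids⇒Av {R₁} {R₂} (_ ∷ b ∷ c ∷ r) av =
  av 0 (s≤s (s≤s (s≤s z≤n))) , Avoids⇒Av (b ∷ c ∷ r) (Avoids-tail {R₁} {R₂} av)

Av⇒Avoids : ∀ {R₁ R₂ n} (e : Vec ℕ n) → Av R₁ R₂ e → Avoids R₁ R₂ e
Av⇒Avoids (_ ∷ _ ∷ _ ∷ _) av zero _ = proj₁ av
Av⇒Avoids {R₁} {R₂} (_ ∷ b ∷ c ∷ r) av (suc i) i+3<n =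
  Av⇒Avoids {R₁} {R₂} (b ∷ c ∷ r) (proj₂ av) i (s≤s⁻¹ i+3<n)
Av⇒Avoids (_ ∷ []) _ _ (s≤s ())
Av⇒Avoids (_ ∷ _ ∷ []) _ _ (s≤s (s≤s ()))

Av≥> Av>≥ : ∀ {n} → Vec ℕ n → Set
Av≥> = Av _≥_ _>_
Av>≥ = Av _>_ _≥_

-- Bounded k e :  e_i ≤ i + k  for every position i (0-based).
-- Inversion sequences are exactly the vectors with Bounded 0.
Bounded : ℕ → ∀ {n} → Vec ℕ n → Set
Bounded k [] = ⊤
Bounded k (x ∷ r) = x ≤ k × Bounded (suc k) r

lookup⇒Bounded : ∀ {n k} (e : Vec ℕ n) → (∀ i → lookup e i ≤ toℕ i + k) → Bounded k e
lookup⇒Bounded [] _ = tt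
lookup⇒Bounded {k = k} (x ∷ r) bound =
  bound fzero , lookup⇒Bounded r (λ i → ≤-trans (bound (fsuc i)) (≤-reflexive (sym (+-suc (toℕ i) k))))

Bounded⇒lookup : ∀ {n k} (e : Vec ℕ n) → Bounded k e → ∀ i → lookup e i ≤ toℕ i + k
Bounded⇒lookup (x ∷ r) (x≤k , _) fzero = x≤k
Bounded⇒lookup {k = k} (x ∷ r) (_ , bound) (fsuc i) =
  ≤-trans (Bounded⇒lookup r bound i) (≤-reflexive (+-suc (toℕ i) k))

IsInvSeq⇒Bounded : ∀ {n} {e : Vec ℕ n} → IsInvSeq e → Bounded 0 e
IsInvSeq⇒Bounded {e = e} inv =
  lookup⇒Bounded e (λ i → ≤-trans (s≤s⁻¹ (inv i)) (≤-reflexive (sym (+-identityʳ (toℕ i)))))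

Bounded⇒IsInvSeq : ∀ {n} {e : Vec ℕ n} → Bounded 0 e → IsInvSeq e
Bounded⇒IsInvSeq {e = e} bound i =
  s≤s (≤-trans (Bounded⇒lookup e bound i) (≤-reflexive (+-identityʳ (toℕ i))))

lastOr : ℕ → ∀ {n} → Vec ℕ n → ℕ
lastOr d [] = d
lastOr d (x ∷ r) = lastOr x r

last≡lastOr : ∀ {n} (x : ℕ) (r : Vec ℕ n) → last (x ∷ r) ≡ lastOr x r
last≡lastOr x [] = refl
last≡lastOr x (y ∷ r) = last≡lastOr y r

HeadAbove HeadAtLeast : ℕ → ∀ {n} → Vec ℕ n → Set
HeadAbove y [] = ⊤
HeadAbove y (z ∷ _) = y < z
HeadAtLeast y [] = ⊤
HeadAtLeast y (z ∷ _) = y ≤ z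

-- a ⇝ b : scanning a from the left, weak ascents x ≤ z are copied, and a
-- descent x > y opens a block which is rewritten by Block.
-- Block x y r s : the block x y^k of  x ∷ y ∷ r  (where r begins with
-- y^(k-1) followed by an entry > y, or ends) becomes  x ∷ s  with
-- s = x^(k-1) y ⋯ , the rest being related by ⇝ again.
mutual
  data _⇝_ : ∀ {n} → Vec ℕ n → Vec ℕ n → Set where
    []      : [] ⇝ []
    [_]     : ∀ x → (x ∷ []) ⇝ (x ∷ [])
    ascent  : ∀ {n x z} {r : Vec ℕ n} {s} → x ≤ z → (z ∷ r) ⇝ s → (x ∷ z ∷ r) ⇝ (x ∷ s)
    descent : ∀ {n x y} {r : Vec ℕ n} {s} → y < x → Block x y r s → (x ∷ y ∷ r) ⇝ (x ∷ s)

  data Block (x y : ℕ) : ∀ {n} → Vec ℕ n → Vec ℕ (suc n) → Set where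
    end    : ∀ {n} {r r' : Vec ℕ n} → HeadAbove y r → r ⇝ r' → Block x y r (y ∷ r')
    repeat : ∀ {n} {r : Vec ℕ n} {s} → Block x y r s → Block x y (y ∷ r) (x ∷ s)

⇝-head : ∀ {n x y} {r s : Vec ℕ n} → (x ∷ r) ⇝ (y ∷ s) → x ≡ y
⇝-head [ x ] = refl
⇝-head (ascent _ _) = refl
⇝-head (descent _ _) = refl

HeadAbove-⇝ : ∀ {n y} {a b : Vec ℕ n} → a ⇝ b → HeadAbove y a → HeadAbove y b
HeadAbove-⇝ {a = []} {[]} _ above = above
HeadAbove-⇝ {y = y} {a = _ ∷ _} {_ ∷ _} a⇝b above = subst (y <_) (⇝-head a⇝b) above

HeadAbove-⇜ : ∀ {n y} {a b : Vec ℕ n} → a ⇝ b → HeadAbove y b → HeadAbove y a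
HeadAbove-⇜ {a = []} {[]} _ above = above
HeadAbove-⇜ {y = y} {a = _ ∷ _} {_ ∷ _} a⇝b above = subst (y <_) (sym (⇝-head a⇝b)) above

-- The last entry is never changed (stated for lastOr so that it holds for
-- every length, including the empty tails met inside blocks).
mutual
  ⇝-lastOr : ∀ {n} d {a b : Vec ℕ n} → a ⇝ b → lastOr d a ≡ lastOr d b
  ⇝-lastOr d [] = refl
  ⇝-lastOr d [ x ] = refl
  ⇝-lastOr d (ascent _ a⇝b) = ⇝-lastOr _ a⇝b
  ⇝-lastOr d (descent _ block) = Block-lastOr _ block

  Block-lastOr : ∀ {n x y} d {r : Vec ℕ n} {s} → Block x y r s → lastOr y r ≡ lastOr d s
  Block-lastOr d (end _ r⇝r') = ⇝-lastOr _ r⇝r'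
  Block-lastOr d (repeat block) = Block-lastOr _ block

⇝-last : ∀ {m} {a b : Vec ℕ (suc m)} → a ⇝ b → last a ≡ last b
⇝-last {a = x ∷ r} {y ∷ s} a⇝b with refl ← ⇝-head a⇝b = begin
  last (x ∷ r)  ≡⟨ last≡lastOr x r ⟩
  lastOr x r    ≡⟨ ⇝-lastOr x a⇝b ⟩
  lastOr x s    ≡⟨ last≡lastOr x s ⟨
  last (x ∷ s)  ∎
  where open ≡-Reasoning

-- The bounds e_i ≤ i + k are preserved in both directions: inside a block
-- the entries x and y move only to positions at least as far right.
mutual
  ⇝-Bounded : ∀ {n k} {a b : Vec ℕ n} → a ⇝ b → Bounded k a → Bounded k b
  ⇝-Bounded [] bound = bound
  ⇝-Bounded [ x ] bound = bound
  ⇝-Bounded (ascent _ a⇝b) (x≤k , bound) = x≤k , ⇝-Bounded a⇝b bound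
  ⇝-Bounded (descent y<x block) (x≤k , _ , bound) =
    x≤k , Block-Bounded y<x block (m≤n⇒m≤1+n x≤k) bound

  Block-Bounded : ∀ {n x y j} {r : Vec ℕ n} {s} → y < x → Block x y r s →
                  x ≤ j → Bounded (suc j) r → Bounded j s
  Block-Bounded y<x (end _ r⇝r') x≤j bound = <⇒≤ (<-≤-trans y<x x≤j) , ⇝-Bounded r⇝r' bound
  Block-Bounded y<x (repeat block) x≤j (_ , bound) =
    x≤j , Block-Bounded y<x block (m≤n⇒m≤1+n x≤j) bound

mutual
  ⇜-Bounded : ∀ {n k} {a b : Vec ℕ n} → a ⇝ b → Bounded k b → Bounded k a
  ⇜-Bounded [] bound = bound
  ⇜-Bounded [ x ] bound = bound
  ⇜-Bounded (ascent _ a⇝b) (x≤k , bound) = x≤k , ⇜-Bounded a⇝b bound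
  ⇜-Bounded (descent y<x block) (x≤k , bound) =
    x≤k , m≤n⇒m≤1+n (<⇒≤ (<-≤-trans y<x x≤k)) , Block-Bounded⁻¹ y<x block (m≤n⇒m≤1+n x≤k) bound

  Block-Bounded⁻¹ : ∀ {n x y j} {r : Vec ℕ n} {s} → y < x → Block x y r s →
                    x ≤ j → Bounded j s → Bounded (suc j) r
  Block-Bounded⁻¹ y<x (end _ r⇝r') x≤j (_ , bound) = ⇜-Bounded r⇝r' bound
  Block-Bounded⁻¹ y<x (repeat block) x≤j (_ , bound) =
    m≤n⇒m≤1+n (<⇒≤ (<-≤-trans y<x x≤j)) , Block-Bounded⁻¹ y<x block (m≤n⇒m≤1+n x≤j) bound

Av≥>-afterDescent : ∀ {n x z} (r : Vec ℕ n) → z ≤ x → Av≥> (x ∷ z ∷ r) → HeadAtLeast z r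
Av≥>-afterDescent [] _ _ = tt
Av≥>-afterDescent (c ∷ r) z≤x (no-pattern , _) = ≮⇒≥ (λ c<z → no-pattern (z≤x , c<z))

Av≥>-ascent : ∀ {n x z} {r : Vec ℕ n} → x < z → Av≥> (z ∷ r) → Av≥> (x ∷ z ∷ r)
Av≥>-ascent {r = []} _ _ = tt
Av≥>-ascent {r = _ ∷ _} x<z av = (λ (z≤x , _) → <⇒≱ x<z z≤x) , av

Av≥>-plateau : ∀ {n x} {r : Vec ℕ n} → HeadAtLeast x r → Av≥> (x ∷ r) → Av≥> (x ∷ x ∷ r)
Av≥>-plateau {r = []} _ _ = tt
Av≥>-plateau {r = _ ∷ _} x≤c av = (λ (_ , c<x) → <⇒≱ c<x x≤c) , av

Av≥>-before : ∀ {n x z} {r : Vec ℕ n} → HeadAbove z r → Av≥> r → Av≥> (x ∷ z ∷ r)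
Av≥>-before {r = []} _ _ = tt
Av≥>-before {r = _ ∷ _} z<c av = (λ (_ , c<z) → <-asym z<c c<z) , Av≥>-ascent z<c av

Av≥>-double : ∀ {n x y} {r : Vec ℕ n} → y ≤ x → Av≥> (x ∷ y ∷ r) → Av≥> (x ∷ y ∷ y ∷ r)
Av≥>-double {r = []} _ _ = (λ (_ , y<y) → <-irrefl refl y<y) , tt
Av≥>-double {r = c ∷ r} y≤x av@(_ , av-tail) =
  (λ (_ , y<y) → <-irrefl refl y<y) , Av≥>-plateau (Av≥>-afterDescent (c ∷ r) y≤x av) av-tail

Av>≥-afterDescent : ∀ {n x z} (r : Vec ℕ n) → z < x → Av>≥ (x ∷ z ∷ r) → HeadAbove z r
Av>≥-afterDescent [] _ _ = tt
Av>≥-afterDescent (c ∷ r) z<x (no-pattern , _) = ≰⇒> (λ c≤z → no-pattern (z<x , c≤z))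

Av>≥-ascent : ∀ {n x z} {r : Vec ℕ n} → x ≤ z → Av>≥ (z ∷ r) → Av>≥ (x ∷ z ∷ r)
Av>≥-ascent {r = []} _ _ = tt
Av>≥-ascent {r = _ ∷ _} x≤z av = (λ (z<x , _) → <⇒≱ z<x x≤z) , av

Av>≥-descent : ∀ {n x y} {r : Vec ℕ n} → y < x → HeadAbove y r → Av>≥ r → Av>≥ (x ∷ y ∷ r)
Av>≥-descent {r = []} _ _ _ = tt
Av>≥-descent {r = c ∷ r} _ y<c av = (λ (_ , c≤y) → <⇒≱ y<c c≤y) , Av>≥-ascent (<⇒≤ y<c) av

-- Every (≥,>)-avoider has an image.  The recursion is on the tail, so that
-- every recursive call is on a subterm.
mutual
  ⇝-total-from : ∀ {n} x (t : Vec ℕ n) → Av≥> (x ∷ t) → Σ (Vec ℕ (suc n)) ((x ∷ t) ⇝_)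
  ⇝-total-from x [] _ = _ , [ x ]
  ⇝-total-from x (z ∷ r) av with x ≤? z
  ... | yes x≤z = _ , ascent x≤z (proj₂ (⇝-total-from z r (Av-tail av)))
  ... | no x≰z =
    _ , descent (≰⇒> x≰z) (proj₂ (Block-total x z r (Av≥>-afterDescent r (≰⇒≥ x≰z) av) (Av-tail av)))

  Block-total : ∀ {n} x y (r : Vec ℕ n) → HeadAtLeast y r → Av≥> (y ∷ r) → Σ _ (Block x y r)
  Block-total x y [] _ _ = _ , end tt []
  Block-total x y (w ∷ r) y≤w av with <-cmp y w
  ... | tri< y<w _ _ = _ , end y<w (proj₂ (⇝-total-from w r (Av-tail av)))
  ... | tri≈ _ refl _ =
    _ , repeat (proj₂ (Block-total x y r (Av≥>-afterDescent r ≤-refl av) (Av-tail av)))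
  ... | tri> _ _ w<y = ⊥-elim (<⇒≱ w<y y≤w)

⇝-total : ∀ {n} (a : Vec ℕ n) → Av≥> a → Σ (Vec ℕ n) (a ⇝_)
⇝-total [] _ = _ , []
⇝-total (x ∷ t) av = ⇝-total-from x t av

-- The image is unique: a weak ascent and a descent cannot both be present.
mutual
  ⇝-functional : ∀ {n} {a b c : Vec ℕ n} → a ⇝ b → a ⇝ c → b ≡ c
  ⇝-functional [] [] = refl
  ⇝-functional [ x ] [ .x ] = refl
  ⇝-functional (ascent _ a⇝b) (ascent _ a⇝c) = cong (_ ∷_) (⇝-functional a⇝b a⇝c)
  ⇝-functional (ascent x≤z _) (descent z<x _) = ⊥-elim (<⇒≱ z<x x≤z)
  ⇝-functional (descent z<x _) (ascent x≤z _) = ⊥-elim (<⇒≱ z<x x≤z)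
  ⇝-functional (descent _ block) (descent _ block') = cong (_ ∷_) (Block-functional block block')

  Block-functional : ∀ {x y n} {r : Vec ℕ n} {s s'} → Block x y r s → Block x y r s' → s ≡ s'
  Block-functional (end _ r⇝r') (end _ r⇝r'') = cong (_ ∷_) (⇝-functional r⇝r' r⇝r'')
  Block-functional (end y<y _) (repeat _) = ⊥-elim (<-irrefl refl y<y)
  Block-functional (repeat _) (end y<y _) = ⊥-elim (<-irrefl refl y<y)
  Block-functional (repeat block) (repeat block') = cong (_ ∷_) (Block-functional block block')

-- Images avoid (>,≥): after a rewritten block x^k y the next entry exceeds y.
mutual
  ⇝-Av>≥ : ∀ {n} {a b : Vec ℕ n} → a ⇝ b → Av>≥ b
  ⇝-Av>≥ [] = tt
  ⇝-Av>≥ [ x ] = tt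
  ⇝-Av>≥ {b = x ∷ w ∷ _} (ascent x≤z a⇝b) =
    Av>≥-ascent (subst (x ≤_) (⇝-head a⇝b) x≤z) (⇝-Av>≥ a⇝b)
  ⇝-Av>≥ (descent y<x block) = Block-Av>≥ y<x block

  Block-Av>≥ : ∀ {x y n} {r : Vec ℕ n} {s} → y < x → Block x y r s → Av>≥ (x ∷ s)
  Block-Av>≥ y<x (end above r⇝r') = Av>≥-descent y<x (HeadAbove-⇝ r⇝r' above) (⇝-Av>≥ r⇝r')
  Block-Av>≥ y<x (repeat block) = Av>≥-ascent ≤-refl (Block-Av>≥ y<x block)

Preimage : ∀ {n} → Vec ℕ n → Set
Preimage {n} b = Σ (Vec ℕ n) λ a → a ⇝ b × Av≥> a

-- A preimage of x ∷ t yields one of x ∷ x ∷ t: either the plateau x x is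
-- copied, or the block x y^k becomes x y^(k+1).
Preimage-double : ∀ {n x} {t : Vec ℕ n} → Preimage (x ∷ t) → Preimage (x ∷ x ∷ t)
Preimage-double (_ , [ x ] , _) = _ , ascent ≤-refl [ x ] , tt
Preimage-double (_ , ascent x≤z a⇝b , av) = _ , ascent ≤-refl (ascent x≤z a⇝b) , Av≥>-plateau x≤z av
Preimage-double (_ , descent y<x block , av) = _ , descent y<x (repeat block) , Av≥>-double (<⇒≤ y<x) av

mutual
  preimage : ∀ {n} (b : Vec ℕ n) → Av>≥ b → Preimage b
  preimage [] _ = _ , [] , tt
  preimage (x ∷ t) av = preimage-from x t av

  preimage-from : ∀ {n} x (t : Vec ℕ n) → Av>≥ (x ∷ t) → Preimage (x ∷ t)
  preimage-from x [] _ = _ , [ x ] , tt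
  preimage-from x (z ∷ r) av with <-cmp x z
  ... | tri< x<z _ _ with preimage-from z r (Av-tail av)
  ...   | z ∷ a , a⇝b , av' with refl ← ⇝-head a⇝b =
    _ , ascent (<⇒≤ x<z) a⇝b , Av≥>-ascent x<z av'
  preimage-from x (.x ∷ r) av | tri≈ _ refl _ = Preimage-double (preimage-from x r (Av-tail av))
  preimage-from x (z ∷ r) av | tri> _ _ z<x with preimage r (Av-tail (Av-tail av))
  ... | a , a⇝r , av' with above ← HeadAbove-⇜ a⇝r (Av>≥-afterDescent r z<x av) =
    _ , descent z<x (end above a⇝r) , Av≥>-before above av'

-- A weak ascent x ≤ z of a (≥,>)-avoider and a block opened by x produce
-- different images: the block would force a plateau-then-descent x x y.
ascent≢block : ∀ {n x y z} {r r' : Vec ℕ n} {s} → x ≤ z → (z ∷ r) ⇝ s → Block x y r' s → y < x →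
               Av≥> (x ∷ z ∷ r) → ⊥
ascent≢block x≤z z∷r⇝ (end _ _) y<x _ = <⇒≱ y<x (subst (_≤_ _) (⇝-head z∷r⇝) x≤z)
ascent≢block _ (ascent x≤z z∷r⇝) (repeat block) y<x av = ascent≢block x≤z z∷r⇝ block y<x (Av-tail av)
ascent≢block _ (descent y'<x _) (repeat _) _ (no-pattern , _) = no-pattern (≤-refl , y'<x)

mutual
  ⇝-injective : ∀ {n} {a a' b : Vec ℕ n} → a ⇝ b → a' ⇝ b → Av≥> a → Av≥> a' → a ≡ a'
  ⇝-injective [] [] _ _ = refl
  ⇝-injective [ x ] [ .x ] _ _ = refl
  ⇝-injective {a = x ∷ _} (ascent _ a⇝b) (ascent _ a'⇝b) av av' =
    cong (x ∷_) (⇝-injective a⇝b a'⇝b (Av-tail av) (Av-tail av'))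
  ⇝-injective (ascent x≤z a⇝b) (descent y<x block) av _ = ⊥-elim (ascent≢block x≤z a⇝b block y<x av)
  ⇝-injective (descent y<x block) (ascent x≤z a⇝b) _ av' = ⊥-elim (ascent≢block x≤z a⇝b block y<x av')
  ⇝-injective (descent y<x block) (descent y'<x block') av av'
    with refl , refl ← Block-injective y<x y'<x block block'
                         (Av-tail (Av-tail av)) (Av-tail (Av-tail av')) = refl

  Block-injective : ∀ {n x y y'} {r r' : Vec ℕ n} {s} → y < x → y' < x →
                    Block x y r s → Block x y' r' s → Av≥> r → Av≥> r' → y ≡ y' × r ≡ r'
  Block-injective _ _ (end _ r⇝s) (end _ r'⇝s) av av' = refl , ⇝-injective r⇝s r'⇝s av av'
  Block-injective x<x _ (end _ _) (repeat _) _ _ = ⊥-elim (<-irrefl refl x<x)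
  Block-injective _ x<x (repeat _) (end _ _) _ _ = ⊥-elim (<-irrefl refl x<x)
  Block-injective y<x y'<x (repeat block) (repeat block') av av'
    with refl , refl ← Block-injective y<x y'<x block block' (Av-tail av) (Av-tail av') = refl , refl

Φ : ∀ {n} → I _≥_ _>_ n → I _>_ _≥_ n
Φ (a , inv , avoids) =
  let b , a⇝b = ⇝-total a (Avoids⇒Av a avoids)
  in b , Bounded⇒IsInvSeq (⇝-Bounded a⇝b (IsInvSeq⇒Bounded inv)) , Av⇒Avoids b (⇝-Av>≥ a⇝b)

Φ-⇝ : ∀ {n} (e : I _≥_ _>_ n) → proj₁ e ⇝ proj₁ (Φ e)
Φ-⇝ (a , _ , avoids) = proj₂ (⇝-total a (Avoids⇒Av a avoids))

Φ-Av≥> : ∀ {n} (e : I _≥_ _>_ n) → Av≥> (proj₁ e)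
Φ-Av≥> (a , _ , avoids) = Avoids⇒Av a avoids

Φ-injective : ∀ {n} → Injective (_≈I_ {_≥_} {_>_} {n}) (_≈I_ {_>_} {_≥_}) Φ
Φ-injective {x = e} {e'} same-image =
  ⇝-injective (Φ-⇝ e) (subst (proj₁ e' ⇝_) (sym same-image) (Φ-⇝ e')) (Φ-Av≥> e) (Φ-Av≥> e')

Φ-surjective : ∀ {n} → Surjective (_≈I_ {_≥_} {_>_} {n}) (_≈I_ {_>_} {_≥_}) Φ
Φ-surjective (b , inv , avoids) =
  let a , a⇝b , av = preimage b (Avoids⇒Av b avoids)
  in (a , Bounded⇒IsInvSeq (⇜-Bounded a⇝b (IsInvSeq⇒Bounded inv)) , Av⇒Avoids a av)
   , λ { {e'} refl → ⇝-functional (Φ-⇝ e') a⇝b }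

Φ-bijective : ∀ {n} → Bijective (_≈I_ {_≥_} {_>_} {n}) (_≈I_ {_>_} {_≥_}) Φ
-- (the implicit arguments of Injective cannot be inferred through _≈I_)
Φ-bijective = (λ {e} {e'} → Φ-injective {x = e} {e'}) , Φ-surjective

Φ-last : ∀ {m} (e : I _≥_ _>_ (suc m)) → last (proj₁ (Φ e)) ≡ last (proj₁ e)
Φ-last e = sym (⇝-last (Φ-⇝ e))

proposition3p9 : (m : ℕ) →
    Σ (I _≥_ _>_ (suc m) → I _>_ _≥_ (suc m)) λ Φ →
      Bijective (_≈I_ {_≥_} {_>_}) (_≈I_ {_>_} {_≥_}) Φ
      × (∀ e → last (proj₁ (Φ e)) ≡ last (proj₁ e))
proposition3p9 m = Φ , Φ-bijective , Φ-last
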